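{- Let $G=(V,E)$ be a finite simple graph of order $n$ and $T=n-1$. Let $(x,y,z)$ be an optimal solution of the model minimizing $\sum_{v\in V}x^0_v+\sum_{t\in[T]}z^t$ over binary variables $x^t_v$ ($v\in V$, $t\in\{0,\ldots,T\}$), $y^t_a$ ($a\in A$, $t\in[T]$), $z^t$ ($t\in[T]$) subject to (1) $x^0_v+\sum_{t\in[T]}\sum_{a=(u,v)\in A}y^t_a=1$ for all $v$; (2) $y^t_a\le x^{t-1}_u$ for all $a=(u,v)\in A$, $t\in[T]$; (3) $y^t_a\le x^{t-1}_w$ for all $a=(u,v)\in A$, $w\in N(u)\setminus\{v\}$, $t\in[T]$; (4) $x^t_v=x^{t-1}_v+\sum_{a=(u,v)\in A}y^t_a$ for all $v$, $t\in[T]$; (5) $x^{t-1}_u-x^{t-1}_v+\sum_{w\in N(u)\setminus\{v\}}x^{t-1}_w\le\sum_{a=(w,v)\in A}y^t_a+\deg(u)-1$ for all $(u,v)\in A$, $t\in[T]$; (6) $\frac1n\sum_{v}(x^t_v-x^{t-1}_v)-z^t\le0$ for all $t\in[T]$; (7) $z^t-\sum_{v}(x^t_v-x^{t-1}_v)\le0$ for all $t\in[T]$. Then $C=\{v\in V: x^0_v=1\}$ is a zero forcing set of $G$ such that $\operatorname{th}(G)=\operatorname{th}(G,C)=\sum_{v\in V}x^0_v+\sum_{t\in[T]}z^t$.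
   Context: $[T]=\{1,\ldots,T\}$; $N(u)$ is the neighborhood, $\deg(u)=|N(u)|$; $A$ contains both arcs $(u,v),(v,u)$ for each edge. Standard zero forcing rule: a filled vertex $u$ forces a non-filled vertex $v$ if $v$ is the only non-filled neighbor of $u$. A zero forcing set is a set from which repeated forcing fills all vertices. $\operatorname{pt}(G,C)$ is the number of time steps needed to fill all vertices from $C$ when at each step all possible forces are applied simultaneously ($\infty$ if $C$ is not zero forcing). $\operatorname{th}(G,C)=|C|+\operatorname{pt}(G,C)$ and $\operatorname{th}(G)=\min_{C\subseteq V}\operatorname{th}(G,C)$. -}

module Defs where

open import Data.Bool using (Bool; true; false; _∧_; _∨_; not; if_then_else_)
open import Data.Nat as ℕ using (ℕ; zero; suc; _∸_; _≤_; _<_)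
open import Data.Integer as ℤ using (ℤ)
open import Data.Fin using (Fin; zero; suc)
open import Data.Fin.Properties using (_≟_)
open import Data.Product using (Σ; ∃; _×_; _,_)
open import Relation.Nullary.Decidable using (⌊_⌋)
open import Relation.Binary.PropositionalEquality using (_≡_)
open import Function using (_∘_)

record Graph (n : ℕ) : Set where
  field
    adj     : Fin n → Fin n → Bool
    sym     : ∀ u v → adj u v ≡ adj v u
    irrefl  : ∀ v → adj v v ≡ false
open Graph public

Σℕ : ∀ {n} → (Fin n → ℕ) → ℕ
Σℕ {zero}  f = 0
Σℕ {suc n} f = f zero ℕ.+ Σℕ (f ∘ suc)

Σℤ : ∀ {n} → (Fin n → ℤ) → ℤ
Σℤ {zero}  f = ℤ.0ℤ
Σℤ {suc n} f = f zero ℤ.+ Σℤ (f ∘ suc)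

Σ1to : ℕ → (ℕ → ℕ) → ℕ
Σ1to zero    f = 0
Σ1to (suc T) f = Σ1to T f ℕ.+ f (suc T)

anyF : ∀ {n} → (Fin n → Bool) → Bool
anyF {zero}  f = false
anyF {suc n} f = f zero ∨ anyF (f ∘ suc)

allF : ∀ {n} → (Fin n → Bool) → Bool
allF {zero}  f = true
allF {suc n} f = f zero ∧ allF (f ∘ suc)

b2n : Bool → ℕ
b2n true  = 1
b2n false = 0

b2z : Bool → ℤ
b2z b = ℤ.+ (b2n b)

_≠ᵇ_ : ∀ {n} → Fin n → Fin n → Bool
w ≠ᵇ v = not ⌊ w ≟ v ⌋

module _ {n : ℕ} (G : Graph n) where

  deg : Fin n → ℕ
  deg u = Σℕ (λ w → b2n (adj G u w))

  inNminus : Fin n → Fin n → Fin n → Bool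
  inNminus u v w = adj G u w ∧ (w ≠ᵇ v)

  forces : (Fin n → Bool) → Fin n → Fin n → Bool
  forces S u v = S u ∧ adj G u v ∧ not (S v)
                 ∧ allF (λ w → not (adj G u w) ∨ S w ∨ not (w ≠ᵇ v))

  step : (Fin n → Bool) → (Fin n → Bool)
  step S v = S v ∨ anyF (λ u → forces S u v)

  filledAfter : ℕ → (Fin n → Bool) → (Fin n → Bool)
  filledAfter zero    S = S
  filledAfter (suc k) S = step (filledAfter k S)

  AllFilled : (Fin n → Bool) → Set
  AllFilled S = ∀ v → S v ≡ true

  IsZeroForcingSet : (Fin n → Bool) → Set
  IsZeroForcingSet C = ∃ λ k → AllFilled (filledAfter k C)

  card : (Fin n → Bool) → ℕ
  card C = Σℕ (λ v → b2n (C v))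

  IsPT : (Fin n → Bool) → ℕ → Set
  IsPT C k = AllFilled (filledAfter k C)
           × (∀ j → AllFilled (filledAfter j C) → k ≤ j)

  -- th(G,C) = m   (finite; th(G,C) = ∞ iff C is not zero forcing)
  IsThC : (Fin n → Bool) → ℕ → Set
  IsThC C m = ∃ λ k → IsPT C k × card C ℕ.+ k ≡ m

  IsTh : ℕ → Set
  IsTh m = (∃ λ C → IsThC C m) × (∀ C' m' → IsThC C' m' → m ≤ m')

  -- The integer programming model, with T = n - 1.
  -- x t v ∈ {0,1} for t ∈ {0..T};  y t u v ∈ {0,1} for arcs (u,v), t ∈ [T];
  -- z t ∈ {0,1} for t ∈ [T].  Entries outside these index ranges (and
  -- y-entries at non-arcs) do not occur in the model and are ignored.

  T : ℕ
  T = n ∸ 1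

  X : Set
  X = ℕ → Fin n → Bool
  Y : Set
  Y = ℕ → Fin n → Fin n → Bool
  Z : Set
  Z = ℕ → Bool

  inflow : Y → ℕ → Fin n → ℤ
  inflow y t v = Σℤ (λ u → if adj G u v then b2z (y t u v) else ℤ.0ℤ)

  -- constraints; t ranges over [T], written t = suc s with suc s ≤ T
  Feasible : X → Y → Z → Set
  Feasible x y z =
      (∀ v → b2z (x 0 v) ℤ.+ Σℤ (λ u → if adj G u v
                 then ℤ.+ (Σ1to T (λ t → b2n (y t u v))) else ℤ.0ℤ) ≡ ℤ.1ℤ)
    × (∀ s → suc s ≤ T → ∀ u v → adj G u v ≡ true →
         b2n (y (suc s) u v) ≤ b2n (x s u))
    × (∀ s → suc s ≤ T → ∀ u v → adj G u v ≡ true →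
         ∀ w → inNminus u v w ≡ true →
         b2n (y (suc s) u v) ≤ b2n (x s w))
    × (∀ s → suc s ≤ T → ∀ v →
         b2z (x (suc s) v) ≡ b2z (x s v) ℤ.+ inflow y (suc s) v)
    × (∀ s → suc s ≤ T → ∀ u v → adj G u v ≡ true →
         (b2z (x s u) ℤ.- b2z (x s v))
           ℤ.+ Σℤ (λ w → if inNminus u v w then b2z (x s w) else ℤ.0ℤ)
         ℤ.≤ inflow y (suc s) v ℤ.+ ℤ.+ (deg u) ℤ.- ℤ.1ℤ)
      -- (6), multiplied by n > 0:  Σ_v (x^t_v - x^{t-1}_v) - n z^t ≤ 0
    × (∀ s → suc s ≤ T →
         Σℤ (λ v → b2z (x (suc s) v) ℤ.- b2z (x s v))
           ℤ.- ℤ.+ n ℤ.* b2z (z (suc s)) ℤ.≤ ℤ.0ℤ)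
    × (∀ s → suc s ≤ T →
         b2z (z (suc s)) ℤ.- Σℤ (λ v → b2z (x (suc s) v) ℤ.- b2z (x s v))
           ℤ.≤ ℤ.0ℤ)

  objective : X → Y → Z → ℕ
  objective x y z = Σℕ (λ v → b2n (x 0 v)) ℕ.+ Σ1to T (λ t → b2n (z t))

  Optimal : X → Y → Z → Set
  Optimal x y z = Feasible x y z
    × (∀ x' y' z' → Feasible x' y' z' → objective x y z ≤ objective x' y' z')

{-# OPTIONS --safe #-}
-- A feasible solution is forced to run the zero forcing process from C = {v : x⁰_v = 1}.
-- Constraint (4) makes x monotone in time, (2) and (3) allow y^t_(u,v) = 1 only when u and
-- all its other neighbours are filled at time t - 1, and (5) makes every possible force
-- happen, so x^t is the set filled after t steps.  By (1) every vertex gets filled by time T,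
-- so C is zero forcing, and (6), (7) make z^t the indicator of x^(t-1) ≠ V, so the objective
-- is |C| + pt(G,C).  Conversely each step of a forcing process fills a new vertex, so
-- pt(G,C') ≤ n - 1 for every zero forcing set C', and recording the process of C' gives a
-- feasible solution of objective th(G,C'); optimality then makes the objective equal to th(G).
module Submission where

open import Defs
open import Data.Nat using (ℕ)
open import Data.Product using (_×_)

open import Data.Bool using (Bool; true; false; _∧_; _∨_; not; if_then_else_)
open import Data.Bool.Properties using (¬-not; not-¬; ⇔→≡; if-float) renaming (_≟_ to _≟ᵇ_)
open import Data.Nat as ℕ
  using (zero; suc; pred; _+_; _*_; _∸_; _≤_; _<_; _≤′_; ≤′-refl; ≤′-step; z≤n; s≤s; _<ᵇ_)
import Data.Nat.Properties as ℕₚ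
open import Data.Nat.Solver using (module +-*-Solver)
open import Data.Integer as ℤ using (ℤ; _⊖_)
import Data.Integer.Properties as ℤₚ
open import Data.Fin using (Fin; zero; suc)
open import Data.Fin.Properties using (any?) renaming (_≟_ to _≟ᶠ_)
open import Data.Product using (∃; _,_; proj₁; proj₂)
open import Data.Sum using (_⊎_; inj₁; inj₂)
open import Function using (_∘_; _⇔_; mk⇔; Equivalence)
open import Relation.Nullary using (¬_; yes; no; contradiction)
open import Relation.Nullary.Decidable using (⌊_⌋; _×-dec_)
open import Relation.Binary.PropositionalEquality
  using (_≡_; _≗_; refl; cong; cong₂; trans; subst; subst₂; module ≡-Reasoning)
  renaming (sym to ≡-sym)

open import Algebra.Properties.CommutativeSemigroup ℕₚ.+-commutativeSemigroup using (interchange)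
open import Algebra.Properties.CommutativeSemigroup ℤₚ.+-commutativeSemigroup using (xy∙z≈xz∙y)

open Equivalence using (to; from)

Σℕ-cong : ∀ {n} {f g : Fin n → ℕ} → f ≗ g → Σℕ f ≡ Σℕ g
Σℕ-cong {zero}  f≗g = refl
Σℕ-cong {suc n} f≗g = cong₂ _+_ (f≗g zero) (Σℕ-cong (f≗g ∘ suc))

Σℕ-mono-≤ : ∀ {n} {f g : Fin n → ℕ} → (∀ i → f i ≤ g i) → Σℕ f ≤ Σℕ g
Σℕ-mono-≤ {zero}  f≤g = z≤n
Σℕ-mono-≤ {suc n} f≤g = ℕₚ.+-mono-≤ (f≤g zero) (Σℕ-mono-≤ (f≤g ∘ suc))

Σℕ-mono-< : ∀ {n} {f g : Fin n → ℕ} → (∀ i → f i ≤ g i) → ∀ j → f j < g j → Σℕ f < Σℕ g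
Σℕ-mono-< f≤g zero    fj<gj = ℕₚ.+-mono-<-≤ fj<gj (Σℕ-mono-≤ (f≤g ∘ suc))
Σℕ-mono-< f≤g (suc j) fj<gj = ℕₚ.+-mono-≤-< (f≤g zero) (Σℕ-mono-< (f≤g ∘ suc) j fj<gj)

term≤Σℕ : ∀ {n} (f : Fin n → ℕ) j → f j ≤ Σℕ f
term≤Σℕ f zero    = ℕₚ.m≤m+n _ _
term≤Σℕ f (suc j) = ℕₚ.≤-trans (term≤Σℕ (f ∘ suc) j) (ℕₚ.m≤n+m _ _)

Σℕ-pos⇒ : ∀ {n} (f : Fin n → ℕ) → 0 < Σℕ f → ∃ λ i → 0 < f i
Σℕ-pos⇒ {suc n} f Σf>0 with f zero in f0
... | suc _ = zero , subst (0 <_) (≡-sym f0) (s≤s z≤n)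
... | zero  = let (i , fi>0) = Σℕ-pos⇒ (f ∘ suc) Σf>0 in suc i , fi>0

Σℕ-const0 : ∀ n → Σℕ {n} (λ _ → 0) ≡ 0
Σℕ-const0 zero    = refl
Σℕ-const0 (suc n) = Σℕ-const0 n

Σℕ-≤1⇒≤n : ∀ {n} (f : Fin n → ℕ) → (∀ i → f i ≤ 1) → Σℕ f ≤ n
Σℕ-≤1⇒≤n {zero}  f f≤1 = z≤n
Σℕ-≤1⇒≤n {suc n} f f≤1 = ℕₚ.+-mono-≤ (f≤1 zero) (Σℕ-≤1⇒≤n (f ∘ suc) (f≤1 ∘ suc))

Σℕ-+ : ∀ {n} (f g : Fin n → ℕ) → Σℕ (λ i → f i + g i) ≡ Σℕ f + Σℕ g
Σℕ-+ {zero}  f g = refl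
Σℕ-+ {suc n} f g = trans (cong ((f zero + g zero) +_) (Σℕ-+ (f ∘ suc) (g ∘ suc)))
                         (interchange (f zero) (g zero) _ _)

Σℕ-indicator : ∀ {n} (v : Fin n) → Σℕ (λ w → b2n ⌊ w ≟ᶠ v ⌋) ≡ 1
Σℕ-indicator {suc n} zero    = cong suc (Σℕ-const0 n)
Σℕ-indicator {suc n} (suc v) = trans (Σℕ-cong shift) (Σℕ-indicator v)
  where
  shift : ∀ w → b2n ⌊ suc w ≟ᶠ suc v ⌋ ≡ b2n ⌊ w ≟ᶠ v ⌋
  shift w with w ≟ᶠ v
  ... | yes _ = refl
  ... | no  _ = refl

Σℤ-cong : ∀ {n} {f g : Fin n → ℤ} → f ≗ g → Σℤ f ≡ Σℤ g
Σℤ-cong {zero}  f≗g = refl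
Σℤ-cong {suc n} f≗g = cong₂ ℤ._+_ (f≗g zero) (Σℤ-cong (f≗g ∘ suc))

Σℤ-pos : ∀ {n} (f : Fin n → ℕ) → Σℤ (λ i → ℤ.+ f i) ≡ ℤ.+ Σℕ f
Σℤ-pos {zero}  f = refl
Σℤ-pos {suc n} f = cong (ℤ._+_ (ℤ.+ f zero)) (Σℤ-pos (f ∘ suc))

Σℤ-if : ∀ {n} (b : Fin n → Bool) (f : Fin n → ℕ) →
  Σℤ (λ i → if b i then ℤ.+ f i else ℤ.0ℤ) ≡ ℤ.+ Σℕ (λ i → if b i then f i else 0)
Σℤ-if b f =
  trans (Σℤ-cong (λ i → ≡-sym (if-float (ℤ.+_) (b i)))) (Σℤ-pos (λ i → if b i then f i else 0))

Σ1to-cong : ∀ T {f g : ℕ → ℕ} → (∀ s → suc s ≤ T → f (suc s) ≡ g (suc s)) → Σ1to T f ≡ Σ1to T g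
Σ1to-cong zero    f≡g = refl
Σ1to-cong (suc T) f≡g =
  cong₂ _+_ (Σ1to-cong T (λ s s<T → f≡g s (ℕₚ.m≤n⇒m≤1+n s<T))) (f≡g T ℕₚ.≤-refl)

Σ1to-pos⇒ : ∀ T (f : ℕ → ℕ) → 0 < Σ1to T f → ∃ λ s → suc s ≤ T × 0 < f (suc s)
Σ1to-pos⇒ (suc T) f Σf>0 with f (suc T) in fT
... | suc _ = T , ℕₚ.≤-refl , subst (0 <_) (≡-sym fT) (s≤s z≤n)
... | zero  = let (s , s<T , fs>0) = Σ1to-pos⇒ T f (subst (0 <_) (ℕₚ.+-identityʳ _) Σf>0)
              in s , ℕₚ.m≤n⇒m≤1+n s<T , fs>0

Σ1to-const0 : ∀ T → Σ1to T (λ _ → 0) ≡ 0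
Σ1to-const0 zero    = refl
Σ1to-const0 (suc T) = cong (_+ 0) (Σ1to-const0 T)

if-Σ1to : ∀ b T (f : ℕ → ℕ) → (if b then Σ1to T f else 0) ≡ Σ1to T (λ t → if b then f t else 0)
if-Σ1to true  T f = refl
if-Σ1to false T f = ≡-sym (Σ1to-const0 T)

Σℕ-Σ1to-comm : ∀ {n} T (f : Fin n → ℕ → ℕ) →
  Σℕ (λ i → Σ1to T (f i)) ≡ Σ1to T (λ t → Σℕ (λ i → f i t))
Σℕ-Σ1to-comm {n} zero    f = Σℕ-const0 n
Σℕ-Σ1to-comm     (suc T) f = trans (Σℕ-+ (λ i → Σ1to T (f i)) (λ i → f i (suc T)))
                                   (cong (_+ Σℕ (λ i → f i (suc T))) (Σℕ-Σ1to-comm T f))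

Σ1to-telescope : ∀ (g : ℕ → ℕ) → (∀ t → g t ≤ g (suc t)) → ∀ T →
  g 0 + Σ1to T (λ t → g t ∸ g (pred t)) ≡ g T
Σ1to-telescope g g-mono zero    = ℕₚ.+-identityʳ (g 0)
Σ1to-telescope g g-mono (suc T) = begin
  g 0 + (Σ1to T Δ + (g (suc T) ∸ g T)) ≡⟨ ≡-sym (ℕₚ.+-assoc (g 0) _ _) ⟩
  (g 0 + Σ1to T Δ) + (g (suc T) ∸ g T) ≡⟨ cong (_+ (g (suc T) ∸ g T)) (Σ1to-telescope g g-mono T) ⟩
  g T + (g (suc T) ∸ g T)              ≡⟨ ℕₚ.m+[n∸m]≡n (g-mono T) ⟩
  g (suc T)                            ∎
  where
  open ≡-Reasoning
  Δ : ℕ → ℕ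
  Δ t = g t ∸ g (pred t)

b2n≤1 : ∀ b → b2n b ≤ 1
b2n≤1 true  = s≤s z≤n
b2n≤1 false = z≤n

b2n-mono : ∀ {a b} → (a ≡ true → b ≡ true) → b2n a ≤ b2n b
b2n-mono {false} a⇒b = z≤n
b2n-mono {true}  a⇒b rewrite a⇒b refl = s≤s z≤n

b2n>0⇒true : ∀ {b} → 0 < b2n b → b ≡ true
b2n>0⇒true {true} _ = refl

b2n-≤-true : ∀ {a b} → b2n a ≤ b2n b → a ≡ true → b ≡ true
b2n-≤-true a≤b refl = b2n>0⇒true a≤b

b2n-∨ : ∀ a b → (a ≡ true → b ≡ false) → b2n (a ∨ b) ≡ b2n a + b2n b
b2n-∨ false b _     = refl
b2n-∨ true  b a⇒¬b rewrite a⇒¬b refl = refl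

b2z-sub : ∀ a a' → (a ≡ true → a' ≡ true) → b2z a' ℤ.- b2z a ≡ ℤ.+ (b2n a' ∸ b2n a)
b2z-sub false a'    _    = ℤₚ.+-identityʳ (b2z a')
b2z-sub true  a' a⇒a' rewrite a⇒a' refl = refl

ifᵇ≤cond : ∀ b c → (if b then b2n c else 0) ≤ b2n b
ifᵇ≤cond true  c = b2n≤1 c
ifᵇ≤cond false c = z≤n

ifᵇ≡cond : ∀ b c → (b ≡ true → c ≡ true) → (if b then b2n c else 0) ≡ b2n b
ifᵇ≡cond true  c b⇒c rewrite b⇒c refl = refl
ifᵇ≡cond false c _   = refl

ifᵇ≡body : ∀ b c → (c ≡ true → b ≡ true) → (if b then b2n c else 0) ≡ b2n c
ifᵇ≡body true  c     _   = refl
ifᵇ≡body false false _   = refl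
ifᵇ≡body false true  c⇒b with c⇒b refl
... | ()

ifᵇ>0⇒ : ∀ b c → 0 < (if b then b2n c else 0) → b ≡ true × c ≡ true
ifᵇ>0⇒ true true _ = refl , refl

b2n+≡1⇒>0 : ∀ {a m} → a ≡ false → b2n a + m ≡ 1 → 0 < m
b2n+≡1⇒>0 refl refl = s≤s z≤n

balance⇒mono : ∀ {a a' i} → b2n a' ≡ b2n a + i → a ≡ true → a' ≡ true
balance⇒mono {a' = true}  _  _    = refl
balance⇒mono {a' = false} () refl

balance⇒filled : ∀ {a a' i} → b2n a' ≡ b2n a + i → 0 < i → a' ≡ true
balance⇒filled {a' = true}  _ _ = refl
balance⇒filled {a = false} {a' = false} refl ()
balance⇒filled {a = true}  {a' = false} ()

balance⇒inflow : ∀ {a a' i} → b2n a' ≡ b2n a + i → a ≡ false → a' ≡ true → 0 < i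
balance⇒inflow balance refl refl rewrite ≡-sym balance = s≤s z≤n

sub≤0⇔ : ∀ m n → (ℤ.+ m ℤ.- ℤ.+ n ℤ.≤ ℤ.0ℤ) ⇔ (m ≤ n)
sub≤0⇔ m n = mk⇔ (ℤₚ.drop‿+≤+ ∘ ℤₚ.i-j≤0⇒i≤j) (ℤₚ.i≤j⇒i-j≤0 ∘ ℤ.+≤+)

sub≤sub⇔ : ∀ p q r s → (ℤ.+ p ℤ.- ℤ.+ q ℤ.≤ ℤ.+ r ℤ.- ℤ.+ s) ⇔ (p + s ≤ r + q)
sub≤sub⇔ p q r s = mk⇔
  (⊖-cancelʳ-≤ ∘ subst₂ ℤ._≤_ lhs rhs)
  (subst₂ ℤ._≤_ (≡-sym lhs) (≡-sym rhs) ∘ ℤₚ.⊖-monoˡ-≤ (q + s))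
  where
  open ≡-Reasoning
  shift : ∀ a b c → ℤ.+ a ℤ.- ℤ.+ b ≡ (a + c) ⊖ (b + c)
  shift a b c = begin
    ℤ.+ a ℤ.- ℤ.+ b     ≡⟨ ℤₚ.m-n≡m⊖n a b ⟩
    a ⊖ b               ≡⟨ ≡-sym (ℤₚ.+-cancelˡ-⊖ c a b) ⟩
    (c + a) ⊖ (c + b)   ≡⟨ cong₂ _⊖_ (ℕₚ.+-comm c a) (ℕₚ.+-comm c b) ⟩
    (a + c) ⊖ (b + c)   ∎
  lhs : ℤ.+ p ℤ.- ℤ.+ q ≡ (p + s) ⊖ (q + s)
  lhs = shift p q s
  rhs : ℤ.+ r ℤ.- ℤ.+ s ≡ (r + q) ⊖ (q + s)
  rhs = trans (shift r s q) (cong ((r + q) ⊖_) (ℕₚ.+-comm s q))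
  ⊖-cancelʳ-≤ : ∀ {a b} → a ⊖ (q + s) ℤ.≤ b ⊖ (q + s) → a ≤ b
  ⊖-cancelʳ-≤ a⊖≤b⊖ = ℕₚ.≮⇒≥ (λ b<a → ℤₚ.<⇒≱ (ℤₚ.⊖-monoˡ-< (q + s) b<a) a⊖≤b⊖)

anyF⁺ : ∀ {n} (f : Fin n → Bool) i → f i ≡ true → anyF f ≡ true
anyF⁺ f zero    fi rewrite fi = refl
anyF⁺ f (suc i) fi with f zero
... | true  = refl
... | false = anyF⁺ (f ∘ suc) i fi

anyF⁻ : ∀ {n} (f : Fin n → Bool) → anyF f ≡ true → ∃ λ i → f i ≡ true
anyF⁻ {suc n} f any with f zero in f0
... | true  = zero , f0
... | false = let (i , fi) = anyF⁻ (f ∘ suc) any in suc i , fi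

allF⁺ : ∀ {n} (f : Fin n → Bool) → (∀ i → f i ≡ true) → allF f ≡ true
allF⁺ {zero}  f all = refl
allF⁺ {suc n} f all rewrite all zero = allF⁺ (f ∘ suc) (all ∘ suc)

allF⁻ : ∀ {n} (f : Fin n → Bool) → allF f ≡ true → ∀ i → f i ≡ true
allF⁻ {suc n} f all i with f zero in f0 | all
allF⁻ {suc n} f all zero    | true | _    = f0
allF⁻ {suc n} f all (suc i) | true | all' = allF⁻ (f ∘ suc) all' i

anyF-cong : ∀ {n} {f g : Fin n → Bool} → f ≗ g → anyF f ≡ anyF g
anyF-cong {zero}  f≗g = refl
anyF-cong {suc n} f≗g = cong₂ _∨_ (f≗g zero) (anyF-cong (f≗g ∘ suc))

allF-cong : ∀ {n} {f g : Fin n → Bool} → f ≗ g → allF f ≡ allF g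
allF-cong {zero}  f≗g = refl
allF-cong {suc n} f≗g = cong₂ _∧_ (f≗g zero) (allF-cong (f≗g ∘ suc))

first : ∀ {n} → (Fin n → Bool) → Fin n → Bool
first f zero    = f zero
first f (suc i) = not (f zero) ∧ first (f ∘ suc) i

first⇒ : ∀ {n} (f : Fin n → Bool) i → first f i ≡ true → f i ≡ true
first⇒ f zero    fst = fst
first⇒ f (suc i) fst with f zero | fst
... | false | fst' = first⇒ (f ∘ suc) i fst'

Σℕ-first : ∀ {n} (f : Fin n → Bool) → Σℕ (λ i → b2n (first f i)) ≡ b2n (anyF f)
Σℕ-first {zero}  f = refl
Σℕ-first {suc n} f with f zero
... | true  = cong suc (Σℕ-const0 n)
... | false = Σℕ-first (f ∘ suc)

cardDiff : ∀ {n} → (Fin n → Bool) → (Fin n → Bool) → ℕ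
cardDiff S S' = Σℕ (λ v → b2n (S' v) ∸ b2n (S v))

cardDiff≤n : ∀ {n} (S S' : Fin n → Bool) → cardDiff S S' ≤ n
cardDiff≤n S S' =
  Σℕ-≤1⇒≤n _ (λ v → ℕₚ.≤-trans (ℕₚ.m∸n≤m (b2n (S' v)) (b2n (S v))) (b2n≤1 (S' v)))

cardDiff>0 : ∀ {n} (S S' : Fin n → Bool) v → S' v ≡ true → S v ≡ false → 0 < cardDiff S S'
cardDiff>0 S S' v S'v Sv =
  ℕₚ.≤-trans (ℕₚ.≤-reflexive (cong₂ (λ a b → b2n a ∸ b2n b) (≡-sym S'v) (≡-sym Sv)))
             (term≤Σℕ (λ w → b2n (S' w) ∸ b2n (S w)) v)

Σℤ-sub≡cardDiff : ∀ {n} (S S' : Fin n → Bool) → (∀ v → S v ≡ true → S' v ≡ true) →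
  Σℤ (λ v → b2z (S' v) ℤ.- b2z (S v)) ≡ ℤ.+ cardDiff S S'
Σℤ-sub≡cardDiff S S' S⊆S' = trans (Σℤ-cong (λ v → b2z-sub (S v) (S' v) (S⊆S' v)))
                                   (Σℤ-pos (λ v → b2n (S' v) ∸ b2n (S v)))

indicator-from-bounds : ∀ b {D m} → b2n b ≤ D → D ≤ m * b2n b → b ≡ (0 <ᵇ D)
indicator-from-bounds true  (s≤s _) _ = refl
indicator-from-bounds false {m = m} _ D≤0
  rewrite ℕₚ.n≤0⇒n≡0 (ℕₚ.≤-trans D≤0 (ℕₚ.≤-reflexive (ℕₚ.*-zeroʳ m))) = refl

falseCount : (ℕ → Bool) → ℕ → ℕ
falseCount f T = Σ1to T (λ t → b2n (not (f (pred t))))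

module _ (f : ℕ → Bool) (f-step : ∀ s → f s ≡ true → f (suc s) ≡ true) where

  private
    f-mono : ∀ {s j} → s ≤ j → f s ≡ true → f j ≡ true
    f-mono s≤j = go (ℕₚ.≤⇒≤′ s≤j)
      where
      go : ∀ {s j} → s ≤′ j → f s ≡ true → f j ≡ true
      go ≤′-refl        fs = fs
      go (≤′-step s≤′j) fs = f-step _ (go s≤′j fs)

    f-false : ∀ T → f (suc T) ≡ false → f T ≡ false
    f-false T fsT = ¬-not (λ fT → not-¬ (f-step T fT) fsT)

    falseCount-true : ∀ T → f T ≡ true → falseCount f (suc T) ≡ falseCount f T
    falseCount-true T fT rewrite fT = ℕₚ.+-identityʳ (falseCount f T)

    falseCount-false : ∀ T → f T ≡ false → falseCount f (suc T) ≡ suc T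
    falseCount-false zero    f0  rewrite f0 = refl
    falseCount-false (suc T) fsT rewrite fsT | falseCount-false T (f-false T fsT) =
      ℕₚ.+-comm (suc T) 1

  falseCount-least : ∀ T → f T ≡ true →
    f (falseCount f T) ≡ true × (∀ j → f j ≡ true → falseCount f T ≤ j)
  falseCount-least zero    f0  = f0 , λ _ _ → z≤n
  falseCount-least (suc T) fsT with f T ≟ᵇ true
  ... | yes fT rewrite falseCount-true T fT = falseCount-least T fT
  ... | no ¬fT rewrite falseCount-false T (¬-not ¬fT) =
    fsT , λ j fj → ℕₚ.≰⇒> (λ j≤T → ¬fT (f-mono j≤T fj))

forcing-inequality : ∀ {a b i c m} → a ≤ 1 → c ≤ m → c < m ⊎ a ≤ i + b →
  a + c + 1 ≤ i + (m + 1) + b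
forcing-inequality {a} {b} {i} {c} {m} a≤1 c≤m (inj₁ c<m) = begin
  a + c + 1       ≤⟨ ℕₚ.+-monoˡ-≤ 1 (ℕₚ.+-monoˡ-≤ c a≤1) ⟩
  suc c + 1       ≤⟨ ℕₚ.+-monoˡ-≤ 1 c<m ⟩
  m + 1           ≤⟨ ℕₚ.m≤n+m (m + 1) i ⟩
  i + (m + 1)     ≤⟨ ℕₚ.m≤m+n (i + (m + 1)) b ⟩
  i + (m + 1) + b ∎
  where open ℕₚ.≤-Reasoning
forcing-inequality {a} {b} {i} {c} {m} a≤1 c≤m (inj₂ a≤i+b) = begin
  a + c + 1       ≤⟨ ℕₚ.+-monoˡ-≤ 1 (ℕₚ.+-mono-≤ a≤i+b c≤m) ⟩
  i + b + m + 1   ≡⟨ rearrange i b m ⟩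
  i + (m + 1) + b ∎
  where
  open ℕₚ.≤-Reasoning
  open +-*-Solver
  rearrange : ∀ i b m → i + b + m + 1 ≡ i + (m + 1) + b
  rearrange = solve 3 (λ i b m → i :+ b :+ m :+ con 1 := i :+ (m :+ con 1) :+ b) refl

forcing-inequality⇒inflow>0 : ∀ {a b i c d m} → a ≡ 1 → b ≡ 0 → c ≡ m → d ≡ m + 1 →
  a + c + 1 ≤ i + d + b → 0 < i
forcing-inequality⇒inflow>0 {i = i} {m = m} refl refl refl refl bound =
  ℕₚ.+-cancelʳ-≤ (m + 1) 1 i (subst (suc (m + 1) ≤_) (ℕₚ.+-identityʳ (i + (m + 1))) bound)

implicationᵇ : ∀ a b c → (not a ∨ b ∨ not c ≡ true) ⇔ (a ∧ c ≡ true → b ≡ true)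
implicationᵇ a b c = mk⇔ (⇒-elim a b c) (⇒-intro a b c)
  where
  ⇒-elim : ∀ a b c → not a ∨ b ∨ not c ≡ true → a ∧ c ≡ true → b ≡ true
  ⇒-elim true true  true _   _ = refl
  ⇒-elim true false true ()  _
  ⇒-intro : ∀ a b c → (a ∧ c ≡ true → b ≡ true) → not a ∨ b ∨ not c ≡ true
  ⇒-intro false _     _     _   = refl
  ⇒-intro true  true  _     _   = refl
  ⇒-intro true  false false _   = refl
  ⇒-intro true  false true  a∧c⇒b = a∧c⇒b refl

module _ {n : ℕ} (G : Graph n) where

  OthersFilled : (Fin n → Bool) → Fin n → Fin n → Set
  OthersFilled S u v = ∀ w → inNminus G u v w ≡ true → S w ≡ true

  forces⇒ : ∀ S u v → forces G S u v ≡ true →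
    S u ≡ true × adj G u v ≡ true × S v ≡ false × OthersFilled S u v
  forces⇒ S u v fuv with S u | adj G u v | S v | fuv
  ... | true | true | false | others =
    refl , refl , refl ,
    λ w → to (implicationᵇ (adj G u w) (S w) (w ≠ᵇ v)) (allF⁻ _ others w)

  ⇒forces : ∀ {S u v} → S u ≡ true → adj G u v ≡ true → S v ≡ false → OthersFilled S u v →
    forces G S u v ≡ true
  ⇒forces {S} {u} {v} Su uv Sv others rewrite Su | uv | Sv =
    allF⁺ _ (λ w → from (implicationᵇ (adj G u w) (S w) (w ≠ᵇ v)) (others w))

  step⇔ : ∀ S v → step G S v ≡ true ⇔ (S v ≡ true ⊎ ∃ λ u → forces G S u v ≡ true)
  step⇔ S v = mk⇔ ⇒filled-or-forced filled-or-forced⇒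
    where
    ⇒filled-or-forced : step G S v ≡ true → S v ≡ true ⊎ ∃ λ u → forces G S u v ≡ true
    ⇒filled-or-forced stepv with S v
    ... | true  = inj₁ refl
    ... | false = inj₂ (anyF⁻ _ stepv)
    filled-or-forced⇒ : S v ≡ true ⊎ (∃ λ u → forces G S u v ≡ true) → step G S v ≡ true
    filled-or-forced⇒ (inj₁ Sv) rewrite Sv = refl
    filled-or-forced⇒ (inj₂ (u , fuv)) with S v
    ... | true  = refl
    ... | false = anyF⁺ _ u fuv

  step-extensive : ∀ S v → S v ≡ true → step G S v ≡ true
  step-extensive S v Sv = from (step⇔ S v) (inj₁ Sv)

  forced-unfilled : ∀ S v → S v ≡ true → anyF (λ u → forces G S u v) ≡ false
  forced-unfilled S v Sv = ¬-not λ any →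
    let (u , fuv) = anyF⁻ _ any in not-¬ Sv (proj₁ (proj₂ (proj₂ (forces⇒ S u v fuv))))

  step-cong : ∀ {S S'} → S ≗ S' → step G S ≗ step G S'
  step-cong {S} {S'} S≗S' v = cong₂ _∨_ (S≗S' v) (anyF-cong forces-cong)
    where
    forces-cong : ∀ u → forces G S u v ≡ forces G S' u v
    forces-cong u = cong₂ (λ a b → a ∧ adj G u v ∧ b) (S≗S' u)
      (cong₂ (λ a b → not a ∧ b) (S≗S' v)
        (allF-cong (λ w → cong (λ a → not (adj G u w) ∨ a ∨ not (w ≠ᵇ v)) (S≗S' w))))

  step-empty : ∀ S → (∀ v → S v ≡ false) → step G S ≗ S
  step-empty S empty v = trans (¬-not filled-or-forced) (≡-sym (empty v))
    where
    filled-or-forced : ¬ (step G S v ≡ true)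
    filled-or-forced stepv with to (step⇔ S v) stepv
    ... | inj₁ Sv        = not-¬ Sv (empty v)
    ... | inj₂ (u , fuv) = not-¬ (proj₁ (forces⇒ S u v fuv)) (empty u)

  filledAfter-mono : ∀ C {s j} → s ≤ j → ∀ v → filledAfter G s C v ≡ true → filledAfter G j C v ≡ true
  filledAfter-mono C {s} s≤j v = go (ℕₚ.≤⇒≤′ s≤j)
    where
    go : ∀ {j} → s ≤′ j → filledAfter G s C v ≡ true → filledAfter G j C v ≡ true
    go ≤′-refl        filled = filled
    go (≤′-step {j} s≤′j) filled = step-extensive (filledAfter G j C) v (go s≤′j filled)

  filledAfter-stable : ∀ C s → step G (filledAfter G s C) ≗ filledAfter G s C →
    ∀ {j} → s ≤ j → filledAfter G j C ≗ filledAfter G s C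
  filledAfter-stable C s fixed s≤j = go (ℕₚ.≤⇒≤′ s≤j)
    where
    go : ∀ {j} → s ≤′ j → filledAfter G j C ≗ filledAfter G s C
    go ≤′-refl        v = refl
    go (≤′-step s≤′j) v = trans (step-cong (go s≤′j) v) (fixed v)

  -- If step s filled nothing new, the process would stay at the unfilled set forever.
  newly-filled : ∀ C {k} s → AllFilled G (filledAfter G k C) → ¬ AllFilled G (filledAfter G s C) →
    ∃ λ v → filledAfter G (suc s) C v ≡ true × filledAfter G s C v ≡ false
  newly-filled C {k} s filled unfilled
    with any? (λ v → (filledAfter G (suc s) C v ≟ᵇ true) ×-dec (filledAfter G s C v ≟ᵇ false))
  ... | yes found = found
  ... | no  none  = contradiction filled-s unfilled
    where
    fixed : step G (filledAfter G s C) ≗ filledAfter G s C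
    fixed v with filledAfter G s C v ≟ᵇ true
    ... | yes Sv = trans (step-extensive (filledAfter G s C) v Sv) (≡-sym Sv)
    ... | no ¬Sv = trans (¬-not (λ stepv → none (v , stepv , ¬-not ¬Sv))) (≡-sym (¬-not ¬Sv))
    filled-s : AllFilled G (filledAfter G s C)
    filled-s v = trans (≡-sym (filledAfter-stable C s fixed (ℕₚ.m≤n⊔m k s) v))
                       (filledAfter-mono C (ℕₚ.m≤m⊔n k s) v (filled v))

  allF-filledAfter-step : ∀ C s → allF (filledAfter G s C) ≡ true → allF (filledAfter G (suc s) C) ≡ true
  allF-filledAfter-step C s all =
    allF⁺ _ (λ v → step-extensive (filledAfter G s C) v (allF⁻ _ all v))

  IsPT-unique : ∀ {C k k'} → IsPT G C k → IsPT G C k' → k ≡ k'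
  IsPT-unique (filled , least) (filled' , least') = ℕₚ.≤-antisym (least _ filled') (least' _ filled)

  IsPT-falseCount : ∀ C T → AllFilled G (filledAfter G T C) →
    IsPT G C (falseCount (λ s → allF (filledAfter G s C)) T)
  IsPT-falseCount C T filled =
    let (all-k , least) = falseCount-least _ (allF-filledAfter-step C) T (allF⁺ _ filled)
    in allF⁻ _ all-k , λ j filled-j → least j (allF⁺ _ filled-j)

  card-step-< : ∀ S v → step G S v ≡ true → S v ≡ false → card G S < card G (step G S)
  card-step-< S v stepv Sv =
    Σℕ-mono-< (λ w → b2n-mono (step-extensive S w)) v
              (subst₂ (λ a b → b2n a < b2n b) (≡-sym Sv) (≡-sym stepv) (s≤s z≤n))

  card+pt≤n : ∀ {C k} → IsPT G C k → card G C + k ≤ n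
  card+pt≤n {C} {k} (filled , least) = ℕₚ.≤-trans (grows k ℕₚ.≤-refl)
    (Σℕ-≤1⇒≤n _ (λ v → b2n≤1 (filledAfter G k C v)))
    where
    grows : ∀ j → j ≤ k → card G C + j ≤ card G (filledAfter G j C)
    grows zero    _   = ℕₚ.≤-reflexive (ℕₚ.+-identityʳ (card G C))
    grows (suc j) j<k =
      let (v , new , old) = newly-filled C {k} j filled (λ filled-j → ℕₚ.<⇒≱ j<k (least j filled-j))
      in ℕₚ.≤-trans (ℕₚ.≤-reflexive (ℕₚ.+-suc (card G C) j))
                    (ℕₚ.≤-trans (s≤s (grows j (ℕₚ.<⇒≤ j<k))) (card-step-< _ v new old))

  pt≤T : ∀ {C k} → IsPT G C k → k ≤ T G
  pt≤T {C} {k} pt@(filled , least) with card G C in cardC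
  ... | suc c = ℕₚ.m+n≤o⇒m≤o∸n k (begin
    k + 1         ≡⟨ ℕₚ.+-comm k 1 ⟩
    1 + k         ≤⟨ ℕₚ.+-monoˡ-≤ k (s≤s z≤n) ⟩
    suc c + k     ≡⟨ cong (_+ k) (≡-sym cardC) ⟩
    card G C + k  ≤⟨ card+pt≤n pt ⟩
    n             ∎)
    where open ℕₚ.≤-Reasoning
  ... | zero  = ℕₚ.≤-trans (least 0 filled-C) z≤n
    where
    -- From C = ∅ nothing is ever forced, so C was already all of V (that is, n = 0).
    empty : ∀ v → C v ≡ false
    empty v = ¬-not (λ Cv → ℕₚ.<⇒≱ (subst (λ b → 0 < b2n b) (≡-sym Cv) (s≤s z≤n))
                                  (subst (b2n (C v) ≤_) cardC (term≤Σℕ _ v)))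
    filled-C : AllFilled G C
    filled-C v = trans (≡-sym (filledAfter-stable C 0 (step-empty C empty) {k} z≤n v)) (filled v)

  IsPT⇒filled-by-T : ∀ {C k} → IsPT G C k → AllFilled G (filledAfter G (T G) C)
  IsPT⇒filled-by-T {C} pt v = filledAfter-mono C (pt≤T pt) v (proj₁ pt v)

  IsThC-unique : ∀ {C m m'} → IsThC G C m → IsThC G C m' → m ≡ m'
  IsThC-unique {C} (_ , pt , refl) (_ , pt' , refl) = cong (card G C +_) (IsPT-unique pt pt')

  inflowℕ : Y G → ℕ → Fin n → ℕ
  inflowℕ y t v = Σℕ (λ u → if adj G u v then b2n (y t u v) else 0)

  inflow≡ : ∀ y t v → inflow G y t v ≡ ℤ.+ inflowℕ y t v
  inflow≡ y t v = Σℤ-if (λ u → adj G u v) (λ u → b2n (y t u v))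

  otherNeighbours : Fin n → Fin n → ℕ
  otherNeighbours u v = Σℕ (λ w → b2n (inNminus G u v w))

  filledOthers : (Fin n → Bool) → Fin n → Fin n → ℕ
  filledOthers S u v = Σℕ (λ w → if inNminus G u v w then b2n (S w) else 0)

  constraint1⇔ : ∀ (x : X G) (y : Y G) v →
    (b2z (x 0 v) ℤ.+ Σℤ (λ u → if adj G u v
       then ℤ.+ (Σ1to (T G) (λ t → b2n (y t u v))) else ℤ.0ℤ) ≡ ℤ.1ℤ)
    ⇔ (b2n (x 0 v) + Σ1to (T G) (λ t → inflowℕ y t v) ≡ 1)
  constraint1⇔ x y v = mk⇔ (ℤₚ.+-injective ∘ trans (≡-sym lhs)) (trans lhs ∘ cong (ℤ.+_))
    where
    arcs : Σℕ (λ u → if adj G u v then Σ1to (T G) (λ t → b2n (y t u v)) else 0)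
         ≡ Σ1to (T G) (λ t → inflowℕ y t v)
    arcs = trans (Σℕ-cong (λ u → if-Σ1to (adj G u v) (T G) (λ t → b2n (y t u v))))
                 (Σℕ-Σ1to-comm (T G) (λ u t → if adj G u v then b2n (y t u v) else 0))
    lhs : b2z (x 0 v) ℤ.+ Σℤ (λ u → if adj G u v
            then ℤ.+ (Σ1to (T G) (λ t → b2n (y t u v))) else ℤ.0ℤ)
        ≡ ℤ.+ (b2n (x 0 v) + Σ1to (T G) (λ t → inflowℕ y t v))
    lhs = cong (ℤ._+_ (b2z (x 0 v)))
      (trans (Σℤ-if (λ u → adj G u v) (λ u → Σ1to (T G) (λ t → b2n (y t u v)))) (cong (ℤ.+_) arcs))

  constraint4⇔ : ∀ (y : Y G) t a a' v →
    (b2z a' ≡ b2z a ℤ.+ inflow G y t v) ⇔ (b2n a' ≡ b2n a + inflowℕ y t v)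
  constraint4⇔ y t a a' v =
    mk⇔ (λ eq → ℤₚ.+-injective (trans eq rhs)) (λ eq → trans (cong (ℤ.+_) eq) (≡-sym rhs))
    where
    rhs : b2z a ℤ.+ inflow G y t v ≡ ℤ.+ (b2n a + inflowℕ y t v)
    rhs = cong (ℤ._+_ (b2z a)) (inflow≡ y t v)

  constraint5⇔ : ∀ (y : Y G) t S u v →
    ((b2z (S u) ℤ.- b2z (S v)) ℤ.+ Σℤ (λ w → if inNminus G u v w then b2z (S w) else ℤ.0ℤ)
       ℤ.≤ inflow G y t v ℤ.+ ℤ.+ (deg G u) ℤ.- ℤ.1ℤ)
    ⇔ (b2n (S u) + filledOthers S u v + 1 ≤ inflowℕ y t v + deg G u + b2n (S v))
  constraint5⇔ y t S u v =
    mk⇔ (to ineq ∘ subst₂ ℤ._≤_ lhs rhs) (subst₂ ℤ._≤_ (≡-sym lhs) (≡-sym rhs) ∘ from ineq)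
    where
    ineq : (ℤ.+ (b2n (S u) + filledOthers S u v) ℤ.- b2z (S v)
              ℤ.≤ ℤ.+ (inflowℕ y t v + deg G u) ℤ.- ℤ.1ℤ)
         ⇔ (b2n (S u) + filledOthers S u v + 1 ≤ inflowℕ y t v + deg G u + b2n (S v))
    ineq = sub≤sub⇔ (b2n (S u) + filledOthers S u v) (b2n (S v)) (inflowℕ y t v + deg G u) 1
    lhs : (b2z (S u) ℤ.- b2z (S v)) ℤ.+ Σℤ (λ w → if inNminus G u v w then b2z (S w) else ℤ.0ℤ)
        ≡ ℤ.+ (b2n (S u) + filledOthers S u v) ℤ.- b2z (S v)
    lhs = trans (cong (ℤ._+_ (b2z (S u) ℤ.- b2z (S v))) (Σℤ-if (inNminus G u v) (λ w → b2n (S w))))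
                (xy∙z≈xz∙y (b2z (S u)) (ℤ.- b2z (S v)) (ℤ.+ filledOthers S u v))
    rhs : inflow G y t v ℤ.+ ℤ.+ (deg G u) ℤ.- ℤ.1ℤ ≡ ℤ.+ (inflowℕ y t v + deg G u) ℤ.- ℤ.1ℤ
    rhs = cong (λ i → i ℤ.+ ℤ.+ (deg G u) ℤ.- ℤ.1ℤ) (inflow≡ y t v)

  constraint6⇔ : ∀ (S S' : Fin n → Bool) b → (∀ v → S v ≡ true → S' v ≡ true) →
    (Σℤ (λ v → b2z (S' v) ℤ.- b2z (S v)) ℤ.- ℤ.+ n ℤ.* b2z b ℤ.≤ ℤ.0ℤ)
    ⇔ (cardDiff S S' ≤ n * b2n b)
  constraint6⇔ S S' b S⊆S' rewrite Σℤ-sub≡cardDiff S S' S⊆S' | ≡-sym (ℤₚ.pos-* n (b2n b)) =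
    sub≤0⇔ (cardDiff S S') (n * b2n b)

  constraint7⇔ : ∀ (S S' : Fin n → Bool) b → (∀ v → S v ≡ true → S' v ≡ true) →
    (b2z b ℤ.- Σℤ (λ v → b2z (S' v) ℤ.- b2z (S v)) ℤ.≤ ℤ.0ℤ)
    ⇔ (b2n b ≤ cardDiff S S')
  constraint7⇔ S S' b S⊆S' rewrite Σℤ-sub≡cardDiff S S' S⊆S' = sub≤0⇔ (b2n b) (cardDiff S S')

  filledOthers≤ : ∀ S u v → filledOthers S u v ≤ otherNeighbours u v
  filledOthers≤ S u v = Σℕ-mono-≤ (λ w → ifᵇ≤cond (inNminus G u v w) (S w))

  filledOthers-full : ∀ S u v → OthersFilled S u v → filledOthers S u v ≡ otherNeighbours u v
  filledOthers-full S u v others = Σℕ-cong (λ w → ifᵇ≡cond (inNminus G u v w) (S w) (others w))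

  filledOthers-< : ∀ S u v w → inNminus G u v w ≡ true → S w ≡ false →
    filledOthers S u v < otherNeighbours u v
  filledOthers-< S u v w uw Sw = Σℕ-mono-< (λ w → ifᵇ≤cond (inNminus G u v w) (S w)) w unfilled
    where
    unfilled : (if inNminus G u v w then b2n (S w) else 0) < b2n (inNminus G u v w)
    unfilled rewrite uw | Sw = s≤s z≤n

  deg≡otherNeighbours+1 : ∀ u v → adj G u v ≡ true → deg G u ≡ otherNeighbours u v + 1
  deg≡otherNeighbours+1 u v uv =
    trans (Σℕ-cong split)
          (trans (Σℕ-+ (λ w → b2n (inNminus G u v w)) (λ w → b2n ⌊ w ≟ᶠ v ⌋))
                 (cong (otherNeighbours u v +_) (Σℕ-indicator v)))
    where
    split : ∀ w → b2n (adj G u w) ≡ b2n (inNminus G u v w) + b2n ⌊ w ≟ᶠ v ⌋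
    split w with w ≟ᶠ v
    ... | yes refl rewrite uv = refl
    ... | no _ with adj G u w
    ...   | true  = refl
    ...   | false = refl

  -- The solution recording a forcing process

  -- Several vertices may force v at once; charging v to a single forcer keeps its inflow at most 1.
  forcer : (Fin n → Bool) → Fin n → Fin n → Bool
  forcer S u v = first (λ w → forces G S w v) u

  forcer⇒forces : ∀ S u v → forcer S u v ≡ true → forces G S u v ≡ true
  forcer⇒forces S u v = first⇒ (λ w → forces G S w v) u

  forcer⇒filled : ∀ S u v → forcer S u v ≡ true → S u ≡ true
  forcer⇒filled S u v = proj₁ ∘ forces⇒ S u v ∘ forcer⇒forces S u v

  forcer⇒othersFilled : ∀ S u v → forcer S u v ≡ true → OthersFilled S u v
  forcer⇒othersFilled S u v = proj₂ ∘ proj₂ ∘ proj₂ ∘ forces⇒ S u v ∘ forcer⇒forces S u v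

  b2n-step : ∀ S v → b2n (step G S v) ≡ b2n (S v) + b2n (anyF (λ u → forces G S u v))
  b2n-step S v = b2n-∨ (S v) _ (forced-unfilled S v)

  inflow-forcer : ∀ S v →
    Σℕ (λ u → if adj G u v then b2n (forcer S u v) else 0) ≡ b2n (anyF (λ u → forces G S u v))
  inflow-forcer S v = trans
    (Σℕ-cong (λ u → ifᵇ≡body (adj G u v) (forcer S u v)
                      (proj₁ ∘ proj₂ ∘ forces⇒ S u v ∘ forcer⇒forces S u v)))
    (Σℕ-first (λ u → forces G S u v))

  forcer-balance : ∀ S v →
    b2n (step G S v) ≡ b2n (S v) + Σℕ (λ u → if adj G u v then b2n (forcer S u v) else 0)
  forcer-balance S v = trans (b2n-step S v) (cong (b2n (S v) +_) (≡-sym (inflow-forcer S v)))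

  forcer-inequality : ∀ S u v → adj G u v ≡ true →
    b2n (S u) + filledOthers S u v + 1
      ≤ Σℕ (λ w → if adj G w v then b2n (forcer S w v) else 0) + deg G u + b2n (S v)
  forcer-inequality S u v uv rewrite inflow-forcer S v | deg≡otherNeighbours+1 u v uv =
    forcing-inequality {b = b2n (S v)} {i = b2n (anyF (λ w → forces G S w v))}
      (b2n≤1 (S u)) (filledOthers≤ S u v) unfilled-or-forced
    where
    forced : OthersFilled S u v → b2n (S u) ≤ b2n (anyF (λ w → forces G S w v)) + b2n (S v)
    forced others = subst (b2n (S u) ≤_) (trans (b2n-step S v) (ℕₚ.+-comm (b2n (S v)) _))
      (b2n-mono (λ Su → from (step⇔ S v) (filled-or-forced Su)))
      where
      filled-or-forced : S u ≡ true → S v ≡ true ⊎ ∃ λ w → forces G S w v ≡ true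
      filled-or-forced Su with S v ≟ᵇ true
      ... | yes Sv = inj₁ Sv
      ... | no ¬Sv = inj₂ (u , ⇒forces Su uv (¬-not ¬Sv) others)
    unfilled-or-forced : filledOthers S u v < otherNeighbours u v
                       ⊎ b2n (S u) ≤ b2n (anyF (λ w → forces G S w v)) + b2n (S v)
    unfilled-or-forced with any? (λ w → (inNminus G u v w ≟ᵇ true) ×-dec (S w ≟ᵇ false))
    ... | yes (w , uw , Sw) = inj₁ (filledOthers-< S u v w uw Sw)
    ... | no none = inj₂ (forced (λ w uw → ¬-not (λ Sw → none (w , uw , Sw))))

  forcingX : (Fin n → Bool) → X G
  forcingX C t = filledAfter G t C

  forcingY : (Fin n → Bool) → Y G
  forcingY C t = forcer (filledAfter G (pred t) C)

  forcingZ : (Fin n → Bool) → Z G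
  forcingZ C t = not (allF (filledAfter G (pred t) C))

  forcingZ-bounds : ∀ C {k} s → AllFilled G (filledAfter G k C) →
    let D = cardDiff (filledAfter G s C) (filledAfter G (suc s) C)
    in b2n (forcingZ C (suc s)) ≤ D × D ≤ n * b2n (forcingZ C (suc s))
  forcingZ-bounds C {k} s filled with allF (filledAfter G s C) ≟ᵇ true
  ... | yes all rewrite all = z≤n , ℕₚ.≤-reflexive (trans stuck (≡-sym (ℕₚ.*-zeroʳ n)))
    where
    stuck : cardDiff (filledAfter G s C) (filledAfter G (suc s) C) ≡ 0
    stuck = trans (Σℕ-cong (λ v → cong₂ (λ a b → b2n a ∸ b2n b)
                    (step-extensive (filledAfter G s C) v (allF⁻ _ all v)) (allF⁻ _ all v)))
                  (Σℕ-const0 n)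
  ... | no ¬all rewrite ¬-not ¬all =
    let (v , new , old) = newly-filled C {k} s filled (¬all ∘ allF⁺ _)
        S = filledAfter G s C
    in cardDiff>0 S (step G S) v new old ,
       ℕₚ.≤-trans (cardDiff≤n S (step G S)) (ℕₚ.≤-reflexive (≡-sym (ℕₚ.*-identityʳ n)))

  IsThC-forcing : ∀ C → AllFilled G (filledAfter G (T G) C) →
    IsThC G C (objective G (forcingX C) (forcingY C) (forcingZ C))
  IsThC-forcing C filled = _ , IsPT-falseCount C (T G) filled , refl

  forcing-feasible : ∀ C → AllFilled G (filledAfter G (T G) C) →
    Feasible G (forcingX C) (forcingY C) (forcingZ C)
  forcing-feasible C filled =
      (λ v → from (constraint1⇔ (forcingX C) (forcingY C) v) (initial v))
    , (λ s _ u v _ → b2n-mono (forcer⇒filled (S s) u v))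
    , (λ s _ u v _ w uw → b2n-mono (λ yuv → forcer⇒othersFilled (S s) u v yuv w uw))
    , (λ s _ v → from (constraint4⇔ (forcingY C) (suc s) (S s v) (S (suc s) v) v)
                      (forcer-balance (S s) v))
    , (λ s _ u v uv → from (constraint5⇔ (forcingY C) (suc s) (S s) u v)
                           (forcer-inequality (S s) u v uv))
    , (λ s _ → from (constraint6⇔ (S s) (S (suc s)) _ (step-extensive (S s)))
                    (proj₂ (forcingZ-bounds C {T G} s filled)))
    , (λ s _ → from (constraint7⇔ (S s) (S (suc s)) _ (step-extensive (S s)))
                    (proj₁ (forcingZ-bounds C {T G} s filled)))
    where
    S : ℕ → Fin n → Bool
    S t = filledAfter G t C
    initial : ∀ v → b2n (C v) + Σ1to (T G) (λ t → inflowℕ (forcingY C) t v) ≡ 1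
    initial v = trans (cong (b2n (C v) +_) (Σ1to-cong (T G) increment))
                      (trans (Σ1to-telescope g (λ t → b2n-mono (step-extensive (S t) v)) (T G))
                             (cong b2n (filled v)))
      where
      g : ℕ → ℕ
      g t = b2n (S t v)
      increment : ∀ s → suc s ≤ T G → inflowℕ (forcingY C) (suc s) v ≡ g (suc s) ∸ g s
      increment s _ = ≡-sym (trans (cong (_∸ g s) (forcer-balance (S s) v)) (ℕₚ.m+n∸m≡n (g s) _))

  -- Feasible solutions record a forcing process

  module _ {x : X G} {y : Y G} {z : Z G} where

    fill-balance : Feasible G x y z → ∀ s → suc s ≤ T G → ∀ v →
      b2n (x (suc s) v) ≡ b2n (x s v) + inflowℕ y (suc s) v
    fill-balance (_ , _ , _ , balance , _) s s<T v =
      to (constraint4⇔ y (suc s) (x s v) (x (suc s) v) v) (balance s s<T v)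

    x-mono : Feasible G x y z → ∀ s → suc s ≤ T G → ∀ v → x s v ≡ true → x (suc s) v ≡ true
    x-mono feasible s s<T v = balance⇒mono (fill-balance feasible s s<T v)

    inflow>0⇒filled : Feasible G x y z → ∀ s → suc s ≤ T G → ∀ v →
      0 < inflowℕ y (suc s) v → x (suc s) v ≡ true
    inflow>0⇒filled feasible s s<T v = balance⇒filled (fill-balance feasible s s<T v)

    newly-filled⇒forced : Feasible G x y z → ∀ s → suc s ≤ T G → ∀ v →
      x s v ≡ false → x (suc s) v ≡ true → ∃ λ u → forces G (x s) u v ≡ true
    newly-filled⇒forced feasible@(_ , y≤x , y≤others , _) s s<T v old new =
      let (u , arc>0) = Σℕ-pos⇒ _ (balance⇒inflow (fill-balance feasible s s<T v) old new)
          (uv , yuv)  = ifᵇ>0⇒ (adj G u v) (y (suc s) u v) arc>0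
      in u , ⇒forces (b2n-≤-true (y≤x s s<T u v uv) yuv) uv old
                     (λ w uw → b2n-≤-true (y≤others s s<T u v uv w uw) yuv)

    forced⇒filled : Feasible G x y z → ∀ s → suc s ≤ T G → ∀ u v →
      forces G (x s) u v ≡ true → x (suc s) v ≡ true
    forced⇒filled feasible@(_ , _ , _ , _ , bound , _) s s<T u v fuv =
      let (xsu , uv , xsv , others) = forces⇒ (x s) u v fuv
      in inflow>0⇒filled feasible s s<T v
           (forcing-inequality⇒inflow>0 (cong b2n xsu) (cong b2n xsv)
             (filledOthers-full (x s) u v others) (deg≡otherNeighbours+1 u v uv)
             (to (constraint5⇔ y (suc s) (x s) u v) (bound s s<T u v uv)))

    x-step : Feasible G x y z → ∀ s → suc s ≤ T G → x (suc s) ≗ step G (x s)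
    x-step feasible s s<T v = ⇔→≡ (mk⇔ filled⇒step step⇒filled)
      where
      filled⇒step : x (suc s) v ≡ true → step G (x s) v ≡ true
      filled⇒step new with x s v ≟ᵇ true
      ... | yes old = step-extensive (x s) v old
      ... | no ¬old =
        from (step⇔ (x s) v) (inj₂ (newly-filled⇒forced feasible s s<T v (¬-not ¬old) new))
      step⇒filled : step G (x s) v ≡ true → x (suc s) v ≡ true
      step⇒filled stepv with to (step⇔ (x s) v) stepv
      ... | inj₁ old        = x-mono feasible s s<T v old
      ... | inj₂ (u , fuv) = forced⇒filled feasible s s<T u v fuv

    x≗filledAfter : Feasible G x y z → ∀ t → t ≤ T G → x t ≗ filledAfter G t (x 0)
    x≗filledAfter feasible zero    _   v = refl
    x≗filledAfter feasible (suc t) t<T v =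
      trans (x-step feasible t t<T v) (step-cong (x≗filledAfter feasible t (ℕₚ.<⇒≤ t<T)) v)

    x0-zeroForcing : Feasible G x y z → AllFilled G (filledAfter G (T G) (x 0))
    x0-zeroForcing feasible@(initial , _) v with x 0 v ≟ᵇ true
    ... | yes x0v = filledAfter-mono (x 0) {j = T G} z≤n v x0v
    ... | no ¬x0v =
      let (s , s<T , inflow>0) = Σ1to-pos⇒ (T G) (λ t → inflowℕ y t v)
                                   (b2n+≡1⇒>0 (¬-not ¬x0v) (to (constraint1⇔ x y v) (initial v)))
      in filledAfter-mono (x 0) s<T v (trans (≡-sym (x≗filledAfter feasible (suc s) s<T v))
                                             (inflow>0⇒filled feasible s s<T v inflow>0))

    z≡forcingZ : Feasible G x y z → ∀ s → suc s ≤ T G → z (suc s) ≡ forcingZ (x 0) (suc s)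
    z≡forcingZ feasible@(_ , _ , _ , _ , _ , upper , lower) s s<T = begin
      z (suc s)           ≡⟨ indicator-from-bounds (z (suc s)) {m = n} z≤D D≤nz ⟩
      0 <ᵇ D              ≡⟨ ≡-sym (indicator-from-bounds (forcingZ C (suc s)) {m = n} z⁰≤D D≤nz⁰) ⟩
      forcingZ C (suc s)  ∎
      where
      open ≡-Reasoning
      C : Fin n → Bool
      C = x 0
      D : ℕ
      D = cardDiff (filledAfter G s C) (filledAfter G (suc s) C)
      z⁰≤D : b2n (forcingZ C (suc s)) ≤ D
      z⁰≤D = proj₁ (forcingZ-bounds C {T G} s (x0-zeroForcing feasible))
      D≤nz⁰ : D ≤ n * b2n (forcingZ C (suc s))
      D≤nz⁰ = proj₂ (forcingZ-bounds C {T G} s (x0-zeroForcing feasible))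
      D≡ : cardDiff (x s) (x (suc s)) ≡ D
      D≡ = Σℕ-cong (λ v → cong₂ (λ a b → b2n a ∸ b2n b)
             (x≗filledAfter feasible (suc s) s<T v) (x≗filledAfter feasible s (ℕₚ.<⇒≤ s<T) v))
      z≤D : b2n (z (suc s)) ≤ D
      z≤D = subst (b2n (z (suc s)) ≤_) D≡
              (to (constraint7⇔ (x s) (x (suc s)) (z (suc s)) (x-mono feasible s s<T)) (lower s s<T))
      D≤nz : D ≤ n * b2n (z (suc s))
      D≤nz = subst (_≤ n * b2n (z (suc s))) D≡
               (to (constraint6⇔ (x s) (x (suc s)) (z (suc s)) (x-mono feasible s s<T)) (upper s s<T))

    objective≡forcing : Feasible G x y z →
      objective G x y z ≡ objective G (forcingX (x 0)) (forcingY (x 0)) (forcingZ (x 0))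
    objective≡forcing feasible =
      cong (card G (x 0) +_) (Σ1to-cong (T G) (λ s s<T → cong b2n (z≡forcingZ feasible s s<T)))

corollary4p7 : (n : ℕ) (G : Graph n) (x : X G) (y : Y G) (z : Z G) →
    Optimal G x y z →
    IsZeroForcingSet G (x 0)
    × IsThC G (x 0) (objective G x y z)
    × IsTh G (objective G x y z)
corollary4p7 n G x y z (feasible , optimal) = (T G , filled) , thC , (x 0 , thC) , minimal
  where
  filled : AllFilled G (filledAfter G (T G) (x 0))
  filled = x0-zeroForcing G {z = z} feasible
  thC : IsThC G (x 0) (objective G x y z)
  thC = subst (IsThC G (x 0)) (≡-sym (objective≡forcing G {z = z} feasible)) (IsThC-forcing G (x 0) filled)
  minimal : ∀ C m → IsThC G C m → objective G x y z ≤ m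
  minimal C m thC′@(_ , pt , _) = ℕₚ.≤-trans (optimal _ _ _ (forcing-feasible G C filled-C))
                                             (ℕₚ.≤-reflexive (IsThC-unique G (IsThC-forcing G C filled-C) thC′))
    where
    filled-C : AllFilled G (filledAfter G (T G) C)
    filled-C = IsPT⇒filled-by-T G pt
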